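{- Let $s$ be a state of an open shop system with $m$ machines and let $M_i$ be a machine. Define $\mathcal{B}_0=\{M_i\}$ and, for $k\ge 1$, $\mathcal{J}_k=\bigcup_{M\in\mathcal{B}_{k-1}}\mathcal{J}^s(M)$ and $\mathcal{B}_k=\mathcal{B}_{k-1}\cup\bigcup_{J\in\mathcal{J}_k}\mathcal{M}^s(J)$. If $M_i$ belongs to some blocking set $\mathcal{B}$ in state $s$, then $\mathcal{B}_m\subseteq\mathcal{B}$.
   Context: An open shop system consists of $n$ jobs $J_1,\ldots,J_n$ and $m$ machines $M_1,\ldots,M_m$. Each job $J_j$ has a set $\mathcal{M}(J_j)\subseteq\{M_1,\ldots,M_m\}$ of machines on which it must be processed, in an arbitrary order; each machine $M_i$ has a positive integer capacity $\mathrm{cap}(M_i)$. There are two artificial machines $M_0$ and $M_{m+1}$ of unbounded capacity. A state $s$ specifies for every job $J_j$ a machine $M^s(J_j)\in\{M_0,\ldots,M_{m+1}\}$ on which it currently sits and a set $\mathcal{M}^s(J_j)\subseteq\mathcal{M}(J_j)\setminus\{M^s(J_j)\}$ of machines on which it still needs processing; each machine $M_i$, $1\le i\le m$, holds at most $\mathrm{cap}(M_i)$ jobs. $\mathcal{J}^s(M_i)$ denotes the set of jobs $J_j$ with $M^s(J_j)=M_i$. A machine $M$ is full in $s$ if $|\mathcal{J}^s(M)|=\mathrm{cap}(M)$. A nonempty set $\mathcal{B}\subseteq\{M_1,\ldots,M_m\}$ is blocking for $s$ if every machine in $\mathcal{B}$ is full and every job $J$ sitting on a machine of $\mathcal{B}$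 satisfies $\emptyset\neq\mathcal{M}^s(J)\subseteq\mathcal{B}$. -}

module Defs where

open import Data.Nat using (ℕ; zero; suc; _≤_; _<_)
open import Data.Bool using (Bool; true; false)
open import Data.Fin using (Fin; _≟_)
open import Data.Fin.Subset using (Subset; _∈_; _∉_; _⊆_; ∣_∣; Nonempty)
open import Data.Vec using (tabulate)
open import Data.Product using (_×_)
open import Relation.Binary.PropositionalEquality using (_≡_)
open import Relation.Nullary.Decidable using (⌊_⌋)

-- Positions a job may sit on: the artificial machine M_0 (start),
-- a real machine M_{i+1} (real i, i : Fin m), or the artificial machine M_{m+1} (end).
data Pos (m : ℕ) : Set where
  start : Pos m
  real  : Fin m → Pos m
  end   : Pos m

record OpenShop (n m : ℕ) : Set where
  field
    req    : Fin n → Subset m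
    cap    : Fin m → ℕ
    capPos : ∀ i → 0 < cap i

isAt : ∀ {m} → Pos m → Fin m → Bool
isAt start    i = false
isAt (real k) i = ⌊ k ≟ i ⌋
isAt end      i = false

record State {n m : ℕ} (O : OpenShop n m) : Set where
  open OpenShop O
  field
    pos : Fin n → Pos m
    rem : Fin n → Subset m
  jobsOn : Fin m → Subset n
  jobsOn i = tabulate (λ j → isAt (pos j) i)
  field
    remReq  : ∀ j → rem j ⊆ req j
    remPos  : ∀ j i → pos j ≡ real i → i ∉ rem j
    capOK   : ∀ i → ∣ jobsOn i ∣ ≤ cap i

module _ {n m : ℕ} {O : OpenShop n m} (s : State O) where
  open OpenShop O
  open State s

  Full : Fin m → Set
  Full i = ∣ jobsOn i ∣ ≡ cap i

  Blocking : Subset m → Set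
  Blocking B =
    Nonempty B ×
    (∀ i → i ∈ B → Full i) ×
    (∀ j i → pos j ≡ real i → i ∈ B → Nonempty (rem j) × rem j ⊆ B)

  -- InB k i0 k' : machine k' belongs to 𝓑_k (built from 𝓑_0 = {i0}).
  -- 𝓑_k = 𝓑_{k-1} ∪ ⋃ { 𝓜^s(J) | J sits on a machine of 𝓑_{k-1} }.
  data InB (i0 : Fin m) : ℕ → Fin m → Set where
    base : InB i0 zero i0
    keep : ∀ {k i} → InB i0 k i → InB i0 (suc k) i
    grow : ∀ {k i' i j} → InB i0 k i' → pos j ≡ real i' → i ∈ rem j →
           InB i0 (suc k) i

module Submission where

open import Defs
open import Data.Nat using (ℕ)
open import Data.Fin using (Fin)
open import Data.Fin.Subset using (Subset; _∈_; _⊆_)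
open import Data.Product using (_,_; proj₂)
open import Relation.Binary.PropositionalEquality using (_≡_)

module _ {n m : ℕ} {O : OpenShop n m} (s : State O) where
  open State s

  ClosedUnderRemaining : Subset m → Set
  ClosedUnderRemaining B = ∀ j i → pos j ≡ real i → i ∈ B → rem j ⊆ B

  Blocking⇒ClosedUnderRemaining : ∀ {B} → Blocking s B → ClosedUnderRemaining B
  Blocking⇒ClosedUnderRemaining (_ , _ , sitting) j i p i∈B = proj₂ (sitting j i p i∈B)

  InB⇒∈-closed : ∀ {i0 B} → ClosedUnderRemaining B → i0 ∈ B →
                 ∀ {k i} → InB s i0 k i → i ∈ B
  InB⇒∈-closed closed i0∈B base              = i0∈B
  InB⇒∈-closed closed i0∈B (keep i∈Bₖ)       = InB⇒∈-closed closed i0∈B i∈Bₖ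
  InB⇒∈-closed closed i0∈B (grow i'∈Bₖ p i∈) = closed _ _ p (InB⇒∈-closed closed i0∈B i'∈Bₖ) i∈

lemma3p1 : ∀ {n m : ℕ} {O : OpenShop n m} (s : State O) (i0 : Fin m) (B : Subset m) →
           Blocking s B → i0 ∈ B → ∀ i → InB s i0 m i → i ∈ B
lemma3p1 s i0 B blocking i0∈B i = InB⇒∈-closed s (Blocking⇒ClosedUnderRemaining s blocking) i0∈B
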